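{- Let $a,b\in\{0,1\}^n$, let $k\ge 0$, and let $T$ be a term such that at least one of $a,b$ is $k$-far from $T$. Then $\Pr_{z\sim \mathrm{Cube}(a,b)}[T(z)=1]\le 2^{ -k}$, where $z$ is uniform over $\mathrm{Cube}(a,b)$.
   Context: A term is a conjunction of literals over $x_1,\dots,x_n$. For $a,b\in\{0,1\}^n$, $\mathrm{Cube}(a,b)=\{z\in\{0,1\}^n: z_i=a_i \text{ for all } i \text{ with } a_i=b_i\}$. For $x\in\{0,1\}^n$ and a term $T$, $\mathrm{dist}(x,T)$ is the number of literals $\ell$ of $T$ with $\ell(x)=0$; $x$ is $k$-far from $T$ if $\mathrm{dist}(x,T)\ge k$. -}

module Defs where

open import Data.Bool using (Bool; true; false; _∧_; _∨_; not; if_then_else_)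
open import Data.Bool.Properties using () renaming (_≟_ to _≟ᵇ_)
open import Data.Nat using (ℕ; zero; suc; _+_)
open import Data.Fin using (Fin)
open import Data.Vec using (Vec; []; _∷_; lookup)
open import Data.List using (List; []; _∷_; map; _++_; concatMap; allFin; length; filterᵇ; foldr)
open import Data.Product using (_×_; _,_)
open import Relation.Nullary.Decidable using (⌊_⌋)

allᵇ : ∀ {A : Set} → (A → Bool) → List A → Bool
allᵇ p = foldr (λ x r → p x ∧ r) true

Point : ℕ → Set
Point n = Vec Bool n

allPoints : (n : ℕ) → List (Point n)
allPoints zero = [] ∷ []
allPoints (suc n) = map (true ∷_) (allPoints n) ++ map (false ∷_) (allPoints n)

_==_ : Bool → Bool → Bool
x == y = ⌊ x ≟ᵇ y ⌋

-- A literal over x_1..x_n: (i , b) stands for the literal "x_i = b",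
-- i.e. x_i when b = true and ¬x_i when b = false.
Literal : ℕ → Set
Literal n = Fin n × Bool

allLiterals : (n : ℕ) → List (Literal n)
allLiterals n = concatMap (λ i → (i , true) ∷ (i , false) ∷ []) (allFin n)

-- A term is a conjunction of a *set* of literals, given by its
-- characteristic function: T i b = true iff the literal "x_i = b" occurs in T.
Term : ℕ → Set
Term n = Fin n → Bool → Bool

litVal : ∀ {n} → Literal n → Point n → Bool
litVal (i , b) x = lookup x i == b

literalsOf : ∀ {n} → Term n → List (Literal n)
literalsOf T = filterᵇ (λ { (i , b) → T i b }) (allLiterals _)

evalTerm : ∀ {n} → Term n → Point n → Bool
evalTerm T z = allᵇ (λ ℓ → litVal ℓ z) (literalsOf T)

dist : ∀ {n} → Point n → Term n → ℕ
dist x T = length (filterᵇ (λ ℓ → not (litVal ℓ x)) (literalsOf T))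

inCube : ∀ {n} → Point n → Point n → Point n → Bool
inCube a b z = allᵇ (λ i → not (lookup a i == lookup b i) ∨ (lookup z i == lookup a i)) (allFin _)

cubeSize : ∀ {n} → Point n → Point n → ℕ
cubeSize {n} a b = length (filterᵇ (inCube a b) (allPoints n))

cubeSatCount : ∀ {n} → Point n → Point n → Term n → ℕ
cubeSatCount {n} a b T =
  length (filterᵇ (λ z → inCube a b z ∧ evalTerm T z) (allPoints n))

{-# OPTIONS --safe #-}
module Submission where

-- Everything factorises over the coordinates: Cube(a,b) is a product of one-variable cubes,
-- T is the conjunction of its restrictions to single variables, and dist(a,T) is the sum of
-- the per-variable distances. So |{z ∈ Cube(a,b) : T(z)}| · 2^dist(a,T) ≤ |Cube(a,b)| is the
-- product of its one-variable instances, which hold because a literal violated by a_i either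
-- excludes the only value of a fixed coordinate or one of the two values of a free one.
-- The case of b follows from Cube(a,b) = Cube(b,a).

open import Defs
open import Data.Nat using (ℕ; zero; suc; _+_; _*_; _^_; _≤_)
open import Data.Sum using (_⊎_; inj₁; inj₂)
open import Data.Nat.Properties
  using (≤-refl; ≤-trans; *-mono-≤; *-monoʳ-≤; ^-monoʳ-≤; ^-distribˡ-+-*; *-distribʳ-+;
         ≤ᵇ⇒≤; +-identityʳ; +-assoc; *-commutativeSemigroup; module ≤-Reasoning)
open import Data.Bool using (Bool; true; false; _∧_; _∨_; not)
open import Data.Bool.Properties using (∧-assoc; ∧-commutativeMonoid)
open import Data.Fin using (Fin; zero; suc)
open import Data.Vec using (_∷_; []; lookup)
open import Data.List using (List; []; _∷_; map; _++_; concatMap; allFin; length; filterᵇ)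
open import Data.List.Properties using (map-tabulate)
open import Data.Product using (_,_; map₁)
open import Data.Unit using (tt)
open import Function using (_∘_; id)
open import Algebra.Bundles using (CommutativeMonoid)
open import Algebra.Properties.CommutativeSemigroup (CommutativeMonoid.commutativeSemigroup ∧-commutativeMonoid)
  using () renaming (interchange to ∧-interchange)
open import Algebra.Properties.CommutativeSemigroup *-commutativeSemigroup
  using () renaming (interchange to *-interchange)
open import Relation.Binary.PropositionalEquality using (_≡_; refl; sym; trans; cong; cong₂; subst₂; module ≡-Reasoning)

boolToℕ : Bool → ℕ
boolToℕ true = 1
boolToℕ false = 0

count : ∀ {A : Set} → (A → Bool) → List A → ℕ
count p xs = length (filterᵇ p xs)

count-∷ : ∀ {A : Set} (p : A → Bool) x xs → count p (x ∷ xs) ≡ boolToℕ (p x) + count p xs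
count-∷ p x xs with p x
... | true  = refl
... | false = refl

count-++ : ∀ {A : Set} (p : A → Bool) xs ys → count p (xs ++ ys) ≡ count p xs + count p ys
count-++ p []       ys = refl
count-++ p (x ∷ xs) ys with p x
... | true  = cong suc (count-++ p xs ys)
... | false = count-++ p xs ys

count-map : ∀ {A B : Set} (p : B → Bool) (f : A → B) xs → count p (map f xs) ≡ count (p ∘ f) xs
count-map p f []       = refl
count-map p f (x ∷ xs) with p (f x)
... | true  = cong suc (count-map p f xs)
... | false = count-map p f xs

count-cong : ∀ {A : Set} {p q : A → Bool} → (∀ x → p x ≡ q x) → ∀ xs → count p xs ≡ count q xs
count-cong {p = p} {q} p≗q []       = refl
count-cong {p = p} {q} p≗q (x ∷ xs) with p x | q x | p≗q x
... | true  | true  | refl = cong suc (count-cong p≗q xs)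
... | false | false | refl = count-cong p≗q xs

count-false : ∀ {A : Set} (xs : List A) → count (λ _ → false) xs ≡ 0
count-false []       = refl
count-false (x ∷ xs) = count-false xs

count-∧ˡ : ∀ {A : Set} β (p : A → Bool) xs → count (λ x → β ∧ p x) xs ≡ boolToℕ β * count p xs
count-∧ˡ true  p xs = sym (+-identityʳ (count p xs))
count-∧ˡ false p xs = count-false xs

count-filterᵇ : ∀ {A : Set} (p q : A → Bool) xs → count q (filterᵇ p xs) ≡ count (λ x → p x ∧ q x) xs
count-filterᵇ p q []       = refl
count-filterᵇ p q (x ∷ xs) with p x
... | false = count-filterᵇ p q xs
... | true with q x
...   | true  = cong suc (count-filterᵇ p q xs)
...   | false = count-filterᵇ p q xs

allᵇ-map : ∀ {A B : Set} (p : B → Bool) (f : A → B) xs → allᵇ p (map f xs) ≡ allᵇ (p ∘ f) xs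
allᵇ-map p f []       = refl
allᵇ-map p f (x ∷ xs) = cong (p (f x) ∧_) (allᵇ-map p f xs)

allᵇ-cong : ∀ {A : Set} {p q : A → Bool} → (∀ x → p x ≡ q x) → ∀ xs → allᵇ p xs ≡ allᵇ q xs
allᵇ-cong p≗q []       = refl
allᵇ-cong p≗q (x ∷ xs) = cong₂ _∧_ (p≗q x) (allᵇ-cong p≗q xs)

allᵇ-filterᵇ : ∀ {A : Set} (p q : A → Bool) xs → allᵇ q (filterᵇ p xs) ≡ allᵇ (λ x → not (p x) ∨ q x) xs
allᵇ-filterᵇ p q []       = refl
allᵇ-filterᵇ p q (x ∷ xs) with p x
... | true  = cong (q x ∧_) (allᵇ-filterᵇ p q xs)
... | false = allᵇ-filterᵇ p q xs

allFin-suc : ∀ n → allFin (suc n) ≡ zero ∷ map suc (allFin n)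
allFin-suc n = cong (zero ∷_) (sym (map-tabulate id suc))

tailTerm : ∀ {n} → Term (suc n) → Term n
tailTerm T i = T (suc i)

isLiteralOf : ∀ {n} → Term n → Literal n → Bool
isLiteralOf T (i , b) = T i b

evalTerm≡allᵇ : ∀ {n} (T : Term n) z →
  evalTerm T z ≡ allᵇ (λ ℓ → not (isLiteralOf T ℓ) ∨ litVal ℓ z) (allLiterals n)
evalTerm≡allᵇ T z = allᵇ-filterᵇ (isLiteralOf T) (λ ℓ → litVal ℓ z) (allLiterals _)

dist≡count : ∀ {n} (x : Point n) T →
  dist x T ≡ count (λ ℓ → isLiteralOf T ℓ ∧ not (litVal ℓ x)) (allLiterals n)
dist≡count x T = count-filterᵇ (isLiteralOf T) (λ ℓ → not (litVal ℓ x)) (allLiterals _)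

literalPair : ∀ {n} → Fin n → List (Literal n)
literalPair i = (i , true) ∷ (i , false) ∷ []

concatMap-literalPair-suc : ∀ {n} (is : List (Fin n)) →
  concatMap literalPair (map suc is) ≡ map (map₁ suc) (concatMap literalPair is)
concatMap-literalPair-suc []       = refl
concatMap-literalPair-suc (i ∷ is) = cong (λ ls → _ ∷ _ ∷ ls) (concatMap-literalPair-suc is)

allLiterals-suc : ∀ n →
  allLiterals (suc n) ≡ (zero , true) ∷ (zero , false) ∷ map (map₁ suc) (allLiterals n)
allLiterals-suc n = begin
  concatMap literalPair (allFin (suc n))
    ≡⟨ cong (concatMap literalPair) (allFin-suc n) ⟩
  literalPair zero ++ concatMap literalPair (map suc (allFin n))
    ≡⟨ cong (literalPair zero ++_) (concatMap-literalPair-suc (allFin n)) ⟩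
  literalPair zero ++ map (map₁ suc) (allLiterals n) ∎
  where open ≡-Reasoning

-- A term restricted to one variable x: pos and neg say whether x and ¬x occur in it.
holds₁ : (pos neg : Bool) → Bool → Bool
holds₁ pos neg v = (not pos ∨ v == true) ∧ (not neg ∨ v == false)

dist₁ : (pos neg : Bool) → Bool → ℕ
dist₁ pos neg v = boolToℕ (pos ∧ not (v == true)) + boolToℕ (neg ∧ not (v == false))

inCube₁ : Bool → Bool → Bool → Bool
inCube₁ a b v = not (a == b) ∨ v == a

evalTerm-∷ : ∀ {n} (T : Term (suc n)) v (z : Point n) →
  evalTerm T (v ∷ z) ≡ holds₁ (T zero true) (T zero false) v ∧ evalTerm (tailTerm T) z
evalTerm-∷ {n} T v z = begin
  evalTerm T (v ∷ z)
    ≡⟨ evalTerm≡allᵇ T (v ∷ z) ⟩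
  allᵇ sat (allLiterals (suc n))
    ≡⟨ cong (allᵇ sat) (allLiterals-suc n) ⟩
  sat (zero , true) ∧ (sat (zero , false) ∧ allᵇ sat (map (map₁ suc) (allLiterals n)))
    ≡⟨ ∧-assoc (sat (zero , true)) _ _ ⟨
  holds₁ (T zero true) (T zero false) v ∧ allᵇ sat (map (map₁ suc) (allLiterals n))
    ≡⟨ cong (_ ∧_) (allᵇ-map sat (map₁ suc) (allLiterals n)) ⟩
  holds₁ (T zero true) (T zero false) v ∧ allᵇ (sat ∘ map₁ suc) (allLiterals n)
    ≡⟨ cong (_ ∧_) (evalTerm≡allᵇ (tailTerm T) z) ⟨
  holds₁ (T zero true) (T zero false) v ∧ evalTerm (tailTerm T) z ∎
  where
  open ≡-Reasoning
  sat : Literal (suc n) → Bool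
  sat ℓ = not (isLiteralOf T ℓ) ∨ litVal ℓ (v ∷ z)

dist-∷ : ∀ {n} v (x : Point n) (T : Term (suc n)) →
  dist (v ∷ x) T ≡ dist₁ (T zero true) (T zero false) v + dist x (tailTerm T)
dist-∷ {n} v x T = begin
  dist (v ∷ x) T
    ≡⟨ dist≡count (v ∷ x) T ⟩
  count violated (allLiterals (suc n))
    ≡⟨ cong (count violated) (allLiterals-suc n) ⟩
  count violated ((zero , true) ∷ (zero , false) ∷ map (map₁ suc) (allLiterals n))
    ≡⟨ count-∷ violated _ _ ⟩
  boolToℕ (violated (zero , true)) + count violated ((zero , false) ∷ map (map₁ suc) (allLiterals n))
    ≡⟨ cong (boolToℕ (violated (zero , true)) +_) (count-∷ violated _ _) ⟩
  boolToℕ (violated (zero , true)) + (boolToℕ (violated (zero , false)) + count violated (map (map₁ suc) (allLiterals n)))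
    ≡⟨ +-assoc (boolToℕ (violated (zero , true))) _ _ ⟨
  dist₁ (T zero true) (T zero false) v + count violated (map (map₁ suc) (allLiterals n))
    ≡⟨ cong (_ +_) (count-map violated (map₁ suc) (allLiterals n)) ⟩
  dist₁ (T zero true) (T zero false) v + count (violated ∘ map₁ suc) (allLiterals n)
    ≡⟨ cong (_ +_) (dist≡count x (tailTerm T)) ⟨
  dist₁ (T zero true) (T zero false) v + dist x (tailTerm T) ∎
  where
  open ≡-Reasoning
  violated : Literal (suc n) → Bool
  violated ℓ = isLiteralOf T ℓ ∧ not (litVal ℓ (v ∷ x))

inCube-∷ : ∀ {n} a₀ b₀ v (a b z : Point n) →
  inCube (a₀ ∷ a) (b₀ ∷ b) (v ∷ z) ≡ inCube₁ a₀ b₀ v ∧ inCube a b z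
inCube-∷ {n} a₀ b₀ v a b z = trans (cong (allᵇ agrees) (allFin-suc n))
  (cong (inCube₁ a₀ b₀ v ∧_) (allᵇ-map agrees suc (allFin n)))
  where
  agrees : Fin (suc n) → Bool
  agrees i = inCube₁ (lookup (a₀ ∷ a) i) (lookup (b₀ ∷ b) i) (lookup (v ∷ z) i)

countBool : (Bool → Bool) → ℕ
countBool p = boolToℕ (p true) + boolToℕ (p false)

count-allPoints-suc : ∀ n (P : Point (suc n) → Bool) (p : Bool → Bool) (q : Point n → Bool) →
  (∀ v z → P (v ∷ z) ≡ p v ∧ q z) →
  count P (allPoints (suc n)) ≡ countBool p * count q (allPoints n)
count-allPoints-suc n P p q P≡p∧q = begin
  count P (map (true ∷_) (allPoints n) ++ map (false ∷_) (allPoints n))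
    ≡⟨ count-++ P (map (true ∷_) (allPoints n)) _ ⟩
  count P (map (true ∷_) (allPoints n)) + count P (map (false ∷_) (allPoints n))
    ≡⟨ cong₂ _+_ (slice true) (slice false) ⟩
  boolToℕ (p true) * count q (allPoints n) + boolToℕ (p false) * count q (allPoints n)
    ≡⟨ *-distribʳ-+ (count q (allPoints n)) (boolToℕ (p true)) _ ⟨
  countBool p * count q (allPoints n) ∎
  where
  open ≡-Reasoning
  slice : ∀ v → count P (map (v ∷_) (allPoints n)) ≡ boolToℕ (p v) * count q (allPoints n)
  slice v = begin
    count P (map (v ∷_) (allPoints n))      ≡⟨ count-map P (v ∷_) (allPoints n) ⟩
    count (P ∘ (v ∷_)) (allPoints n)       ≡⟨ count-cong (P≡p∧q v) (allPoints n) ⟩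
    count (λ z → p v ∧ q z) (allPoints n)   ≡⟨ count-∧ˡ (p v) q (allPoints n) ⟩
    boolToℕ (p v) * count q (allPoints n)   ∎

cubeSize-∷ : ∀ {n} a₀ b₀ (a b : Point n) →
  cubeSize (a₀ ∷ a) (b₀ ∷ b) ≡ countBool (inCube₁ a₀ b₀) * cubeSize a b
cubeSize-∷ {n} a₀ b₀ a b =
  count-allPoints-suc n (inCube (a₀ ∷ a) (b₀ ∷ b)) (inCube₁ a₀ b₀) (inCube a b) (λ v z → inCube-∷ a₀ b₀ v a b z)

cubeSatCount-∷ : ∀ {n} a₀ b₀ (a b : Point n) (T : Term (suc n)) →
  cubeSatCount (a₀ ∷ a) (b₀ ∷ b) T
    ≡ countBool (λ v → inCube₁ a₀ b₀ v ∧ holds₁ (T zero true) (T zero false) v)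
      * cubeSatCount a b (tailTerm T)
cubeSatCount-∷ {n} a₀ b₀ a b T =
  count-allPoints-suc n (λ z → inCube (a₀ ∷ a) (b₀ ∷ b) z ∧ evalTerm T z)
    (λ v → inCube₁ a₀ b₀ v ∧ holds₁ (T zero true) (T zero false) v)
    (λ z → inCube a b z ∧ evalTerm (tailTerm T) z) split
  where
  split : ∀ v z → inCube (a₀ ∷ a) (b₀ ∷ b) (v ∷ z) ∧ evalTerm T (v ∷ z)
                ≡ (inCube₁ a₀ b₀ v ∧ holds₁ (T zero true) (T zero false) v)
                  ∧ (inCube a b z ∧ evalTerm (tailTerm T) z)
  split v z = trans (cong₂ _∧_ (inCube-∷ a₀ b₀ v a b z) (evalTerm-∷ T v z))
                    (∧-interchange (inCube₁ a₀ b₀ v) _ _ _)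

satisfying-fraction₁ : ∀ a b pos neg →
  countBool (λ v → inCube₁ a b v ∧ holds₁ pos neg v) * 2 ^ dist₁ pos neg a ≤ countBool (inCube₁ a b)
satisfying-fraction₁ true  true  true  true  = ≤ᵇ⇒≤ _ _ tt
satisfying-fraction₁ true  true  true  false = ≤ᵇ⇒≤ _ _ tt
satisfying-fraction₁ true  true  false true  = ≤ᵇ⇒≤ _ _ tt
satisfying-fraction₁ true  true  false false = ≤ᵇ⇒≤ _ _ tt
satisfying-fraction₁ true  false true  true  = ≤ᵇ⇒≤ _ _ tt
satisfying-fraction₁ true  false true  false = ≤ᵇ⇒≤ _ _ tt
satisfying-fraction₁ true  false false true  = ≤ᵇ⇒≤ _ _ tt
satisfying-fraction₁ true  false false false = ≤ᵇ⇒≤ _ _ tt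
satisfying-fraction₁ false true  true  true  = ≤ᵇ⇒≤ _ _ tt
satisfying-fraction₁ false true  true  false = ≤ᵇ⇒≤ _ _ tt
satisfying-fraction₁ false true  false true  = ≤ᵇ⇒≤ _ _ tt
satisfying-fraction₁ false true  false false = ≤ᵇ⇒≤ _ _ tt
satisfying-fraction₁ false false true  true  = ≤ᵇ⇒≤ _ _ tt
satisfying-fraction₁ false false true  false = ≤ᵇ⇒≤ _ _ tt
satisfying-fraction₁ false false false true  = ≤ᵇ⇒≤ _ _ tt
satisfying-fraction₁ false false false false = ≤ᵇ⇒≤ _ _ tt

satisfying-fraction : ∀ n (a b : Point n) (T : Term n) →
  cubeSatCount a b T * 2 ^ dist a T ≤ cubeSize a b
satisfying-fraction zero    []       []       T = ≤-refl
satisfying-fraction (suc n) (a₀ ∷ a) (b₀ ∷ b) T = begin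
  cubeSatCount (a₀ ∷ a) (b₀ ∷ b) T * 2 ^ dist (a₀ ∷ a) T
    ≡⟨ cong₂ (λ s d → s * 2 ^ d) (cubeSatCount-∷ a₀ b₀ a b T) (dist-∷ a₀ a T) ⟩
  (s₁ * s) * 2 ^ (d₁ + d)
    ≡⟨ cong ((s₁ * s) *_) (^-distribˡ-+-* 2 d₁ d) ⟩
  (s₁ * s) * (2 ^ d₁ * 2 ^ d)
    ≡⟨ *-interchange s₁ s (2 ^ d₁) (2 ^ d) ⟩
  (s₁ * 2 ^ d₁) * (s * 2 ^ d)
    ≤⟨ *-mono-≤ (satisfying-fraction₁ a₀ b₀ pos neg) (satisfying-fraction n a b (tailTerm T)) ⟩
  countBool (inCube₁ a₀ b₀) * cubeSize a b
    ≡⟨ cubeSize-∷ a₀ b₀ a b ⟨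
  cubeSize (a₀ ∷ a) (b₀ ∷ b) ∎
  where
  open ≤-Reasoning
  pos = T zero true
  neg = T zero false
  s₁ = countBool (λ v → inCube₁ a₀ b₀ v ∧ holds₁ pos neg v)
  d₁ = dist₁ pos neg a₀
  s = cubeSatCount a b (tailTerm T)
  d = dist a (tailTerm T)

inCube₁-comm : ∀ a b v → inCube₁ a b v ≡ inCube₁ b a v
inCube₁-comm true  true  v = refl
inCube₁-comm true  false v = refl
inCube₁-comm false true  v = refl
inCube₁-comm false false v = refl

inCube-comm : ∀ {n} (a b z : Point n) → inCube a b z ≡ inCube b a z
inCube-comm a b z = allᵇ-cong (λ i → inCube₁-comm (lookup a i) (lookup b i) (lookup z i)) (allFin _)

cubeSize-comm : ∀ {n} (a b : Point n) → cubeSize a b ≡ cubeSize b a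
cubeSize-comm a b = count-cong (inCube-comm a b) (allPoints _)

cubeSatCount-comm : ∀ {n} (a b : Point n) T → cubeSatCount a b T ≡ cubeSatCount b a T
cubeSatCount-comm a b T = count-cong (λ z → cong (_∧ evalTerm T z) (inCube-comm a b z)) (allPoints _)

satisfying-fraction-far : ∀ n (a b : Point n) k T → k ≤ dist a T →
  cubeSatCount a b T * 2 ^ k ≤ cubeSize a b
satisfying-fraction-far n a b k T k≤dist =
  ≤-trans (*-monoʳ-≤ (cubeSatCount a b T) (^-monoʳ-≤ 2 k≤dist)) (satisfying-fraction n a b T)

lemma9 : (n : ℕ) (a b : Point n) (k : ℕ) (T : Term n) →
    (k ≤ dist a T ⊎ k ≤ dist b T) →
    cubeSatCount a b T * 2 ^ k ≤ cubeSize a b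
lemma9 n a b k T (inj₁ a-far) = satisfying-fraction-far n a b k T a-far
lemma9 n a b k T (inj₂ b-far) =
  subst₂ _≤_ (cong (_* 2 ^ k) (cubeSatCount-comm b a T)) (cubeSize-comm b a)
    (satisfying-fraction-far n b a k T b-far)
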